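{- Let $G=(V,E)$ be a connected graph and let $X\subseteq V$ be such that $G[X]$ is connected and $\deg_G(x)\leq 2$ for every $x\in X$. Then $\gamma_{P,1}(G/X)\leq \gamma_{P,1}(G)$, and this bound is tight (there exist such $G$ and $X$ with $\gamma_{P,1}(G/X)=\gamma_{P,1}(G)$).
   Context: Graphs are finite, simple and undirected; $G[X]$ is the induced subgraph. For $X\subseteq V$, the contraction $G/X$ is the graph obtained from $G-X$ by adding a new vertex $v_X$ with $N_{G/X}(v_X)=N_G[X]\setminus X$. For a graph $G=(V,E)$ and $S\subseteq V$, define $\mathscr P^0(S)=N[S]$ and $\mathscr P^{i+1}(S)=\mathscr P^i(S)\cup\bigcup\{N(v): v\in \mathscr P^i(S),\ 1\le |N(v)\setminus \mathscr P^i(S)|\le 1\}$. $S$ is a $1$-power dominating set (power dominating set) of $G$ if $\mathscr P^\ell(S)=V$ for some $\ell$; $\gamma_{P,1}(G)$ is the minimum size of such a set. -}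

module Defs where

open import Data.Nat using (ℕ; zero; suc; _≤_; _≡ᵇ_)
open import Data.Bool using (Bool; true; false; T; _∧_)
open import Data.Fin using (Fin)
open import Data.Fin.Subset using (Subset; _∈_; _∉_; _∪_; _─_; ⋃; ∣_∣; ⊤; Nonempty)
open import Data.Vec using (tabulate; lookup)
open import Data.List using (List; map; filter; allFin)
open import Data.Product using (Σ; ∃; ∃-syntax; _×_; _,_)
open import Relation.Binary.PropositionalEquality using (_≡_; _≢_)
open import Relation.Nullary using (¬_)
open import Relation.Nullary.Decidable using (T?)

record Graph (n : ℕ) : Set where
  field
    adj    : Fin n → Fin n → Bool
    sym    : ∀ u v → adj u v ≡ adj v u
    irrefl : ∀ v → adj v v ≡ false
open Graph public

Adj : ∀ {n} → Graph n → Fin n → Fin n → Set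
Adj G u v = T (adj G u v)

N : ∀ {n} → Graph n → Fin n → Subset n
N G v = tabulate (λ u → adj G v u)

deg : ∀ {n} → Graph n → Fin n → ℕ
deg G v = ∣ N G v ∣

closedNbhd : ∀ {n} → Graph n → Subset n → Subset n
closedNbhd {n} G S =
  S ∪ ⋃ (map (N G) (filter (λ v → T? (lookup S v)) (allFin n)))

forces : ∀ {n} → Graph n → Subset n → Fin n → Bool
forces G P v = lookup P v ∧ (∣ N G v ─ P ∣ ≡ᵇ 1)

propStep : ∀ {n} → Graph n → Subset n → Subset n
propStep {n} G P =
  P ∪ ⋃ (map (N G) (filter (λ v → T? (forces G P v)) (allFin n)))

iterate : ∀ {A : Set} → (A → A) → ℕ → A → A
iterate f zero    a = a
iterate f (suc k) a = f (iterate f k a)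

𝒫 : ∀ {n} → Graph n → ℕ → Subset n → Subset n
𝒫 G i S = iterate (propStep G) i (closedNbhd G S)

IsPDS : ∀ {n} → Graph n → Subset n → Set
IsPDS G S = ∃[ ℓ ] (𝒫 G ℓ S ≡ ⊤)

IsPowerDomNumber : ∀ {n} → Graph n → ℕ → Set
IsPowerDomNumber G k =
  (∃[ S ] (IsPDS G S × ∣ S ∣ ≡ k)) × (∀ S → IsPDS G S → k ≤ ∣ S ∣)

data ReachIn {n} (G : Graph n) (X : Subset n) : Fin n → Fin n → Set where
  here : ∀ {u} → u ∈ X → ReachIn G X u u
  step : ∀ {u w v} → u ∈ X → Adj G u w → ReachIn G X w v → ReachIn G X u v

Connected : ∀ {n} → Graph n → Set
Connected {n} G = ∀ (u v : Fin n) → ReachIn G ⊤ u v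

InducedConnected : ∀ {n} → Graph n → Subset n → Set
InducedConnected G X = ∀ u v → u ∈ X → v ∈ X → ReachIn G X u v

-- H (on Fin m) is the contraction G/X, presented via the quotient map
-- φ : V(G) → V(H) sending every x ∈ X to the new vertex c = v_X and
-- restricting to a bijection V \ X → V(H) \ {c}.
record IsContraction {n m} (G : Graph n) (X : Subset n) (H : Graph m)
                     (φ : Fin n → Fin m) (c : Fin m) : Set where
  field
    onX     : ∀ x → x ∈ X → φ x ≡ c
    offX    : ∀ u → u ∉ X → φ u ≢ c
    inj     : ∀ u v → u ∉ X → v ∉ X → φ u ≡ φ v → u ≡ v
    surj    : ∀ w → w ≢ c → ∃[ u ] (u ∉ X × φ u ≡ w)
    adjOut  : ∀ u v → u ∉ X → v ∉ X → adj H (φ u) (φ v) ≡ adj G u v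
    -- N_{G/X}(v_X) = N_G[X] \ X
    adjC    : ∀ u → u ∉ X → (Adj H c (φ u) → ∃[ x ] (x ∈ X × Adj G x u))
                          × (∀ x → x ∈ X → Adj G x u → Adj H c (φ u))

-- Call a set Q of vertices forcing-closed if no vertex of Q has exactly one neighbour outside Q.
-- The propagation closure of S is the least forcing-closed set containing N[S], and it is reached
-- after finitely many steps. Given a power dominating set S of G, let C be the closure of φ(S) in
-- G/X and pull it back to G: a vertex u ∉ X is covered when φ(u) ∈ C, a vertex of X when the whole
-- closed neighbourhood of v_X lies in C. The pull-back contains N[S] and is forcing-closed in G,
-- hence is everything, so C is everything and φ(S) is a power dominating set of G/X of size at most
-- |S|. The one place where the degree condition enters: a connected set X of vertices of degree at
-- most 2 induces a path or a cycle, so it has at most two outside neighbours and v_X has degree at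
-- most 2; hence once v_X and one of its neighbours lie in a forcing-closed set, so does the other.
module Submission where

open import Defs
open import Data.Nat using (zero; suc; _≤_; _<_; _+_; z≤n; s≤s)
open import Data.Nat.Properties
  using (≤-trans; ≤-reflexive; ≤-antisym; <-irrefl; +-monoʳ-≤; n≤1+n; +-suc; ≡ᵇ⇒≡; ≡⇒≡ᵇ)
open import Data.Bool using (Bool; false; T)
open import Data.Bool.Properties using (T-≡; T-∧)
open import Data.Fin using (Fin; zero; suc)
open import Data.Fin.Properties using (any?) renaming (_≟_ to _≟ᶠ_)
open import Data.Fin.Subset
  using (Subset; inside; outside; _∈_; _∉_; _∪_; _─_; ⋃; ∣_∣; ⊤; ⁅_⁆; _⊆_; Nonempty)
  renaming (⊥ to ∅)
open import Data.Fin.Subset.Properties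
  using ( _∈?_; ∉⊥; ∈⊤; ⊆⊤; ⊆-antisym; x∈p∪q⁻; x∈p∪q⁺; p─q⊆p; x∈p∧x∉q⇒x∈p─q; x∈p∧x≢y⇒x∈p-y
        ; x∈p⇒∣p-x∣<∣p∣; p⊆q⇒∣p∣≤∣q∣; p⊂q⇒∣p∣<∣q∣; ∣p∣≤n; x∈⁅x⁆; x∈⁅y⁆⇔x≡y; ∣⁅x⁆∣≡1; ∣⊥∣≡0)
open import Data.Vec using ([]; _∷_; tabulate; lookup; here; there)
open import Data.Vec.Properties using ([]=⇒lookup; lookup⇒[]=; lookup∘tabulate)
open import Data.List using (List; []; _∷_; map; filter; allFin)
open import Data.List.Relation.Unary.Any using () renaming (here to hereˡ; there to thereˡ)
open import Data.List.Membership.Propositional using () renaming (_∈_ to _∈ˡ_; _∉_ to _∉ˡ_)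
import Data.List.Membership.DecPropositional as DecListMembership
open import Data.List.Membership.Propositional.Properties
  using (∈-map⁻; ∈-map⁺; ∈-filter⁻; ∈-filter⁺; ∈-allFin)
open import Data.Product using (Σ; ∃-syntax; _×_; _,_; proj₁; proj₂)
open import Data.Sum using (_⊎_; inj₁; inj₂)
open import Data.Empty using (⊥; ⊥-elim)
open import Function using (_∘_; Equivalence)
import Relation.Binary.PropositionalEquality as ≡
open ≡ using (_≡_; _≢_; refl; trans; subst)
open import Relation.Nullary using (¬_; Dec; yes; no)
open import Relation.Nullary.Decidable using (T?; ¬?; _×-dec_; decidable-stable)

open Equivalence using (to; from)

∈-tabulate⁺ : ∀ {n} (f : Fin n → Bool) {u} → T (f u) → u ∈ tabulate f
∈-tabulate⁺ f {u} t = lookup⇒[]= u (tabulate f) (trans (lookup∘tabulate f u) (to (T-≡ {f u}) t))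

∈-tabulate⁻ : ∀ {n} (f : Fin n → Bool) {u} → u ∈ tabulate f → T (f u)
∈-tabulate⁻ f {u} u∈ =
  from (T-≡ {f u}) (trans (≡.sym (lookup∘tabulate f u)) ([]=⇒lookup u∈))

∈⇒T-lookup : ∀ {n} {S : Subset n} {v} → v ∈ S → T (lookup S v)
∈⇒T-lookup {S = S} {v} v∈S = from (T-≡ {lookup S v}) ([]=⇒lookup v∈S)

T-lookup⇒∈ : ∀ {n} {S : Subset n} {v} → T (lookup S v) → v ∈ S
T-lookup⇒∈ {S = S} {v} t = lookup⇒[]= v S (to (T-≡ {lookup S v}) t)

x∈p─q⇒x∉q : ∀ {n} {x : Fin n} (p q : Subset n) → x ∈ p ─ q → x ∉ q
x∈p─q⇒x∉q (inside ∷ p)  (inside ∷ q) () here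
x∈p─q⇒x∉q (outside ∷ p) (inside ∷ q) () here
x∈p─q⇒x∉q (_ ∷ p)       (_ ∷ q)      (there x∈p─q) (there x∈q) = x∈p─q⇒x∉q p q x∈p─q x∈q

∈⋃⁻ : ∀ {n} {x : Fin n} (ps : List (Subset n)) → x ∈ ⋃ ps → ∃[ p ] (p ∈ˡ ps × x ∈ p)
∈⋃⁻ []       x∈ = ⊥-elim (∉⊥ x∈)
∈⋃⁻ (p ∷ ps) x∈ with x∈p∪q⁻ p (⋃ ps) x∈
... | inj₁ x∈p  = p , hereˡ refl , x∈p
... | inj₂ x∈ps with ∈⋃⁻ ps x∈ps
...   | q , q∈ps , x∈q = q , thereˡ q∈ps , x∈q

∈⋃⁺ : ∀ {n} {x : Fin n} {p} (ps : List (Subset n)) → p ∈ˡ ps → x ∈ p → x ∈ ⋃ ps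
∈⋃⁺ (p ∷ ps) (hereˡ refl)   x∈p = x∈p∪q⁺ (inj₁ x∈p)
∈⋃⁺ (p ∷ ps) (thereˡ p∈ps) x∈p = x∈p∪q⁺ {p = p} (inj₂ (∈⋃⁺ ps p∈ps x∈p))

1≤∣p∣ : ∀ {n} {x : Fin n} {p} → x ∈ p → 1 ≤ ∣ p ∣
1≤∣p∣ x∈p = ≤-trans (s≤s z≤n) (x∈p⇒∣p-x∣<∣p∣ x∈p)

2≤∣p∣ : ∀ {n} {x y : Fin n} {p} → x ∈ p → y ∈ p → x ≢ y → 2 ≤ ∣ p ∣
2≤∣p∣ x∈p y∈p x≢y = ≤-trans (s≤s (1≤∣p∣ (x∈p∧x≢y⇒x∈p-y y∈p (x≢y ∘ ≡.sym)))) (x∈p⇒∣p-x∣<∣p∣ x∈p)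

3≤∣p∣ : ∀ {n} {x y z : Fin n} {p} → x ∈ p → y ∈ p → z ∈ p → x ≢ y → x ≢ z → y ≢ z → 3 ≤ ∣ p ∣
3≤∣p∣ x∈p y∈p z∈p x≢y x≢z y≢z =
  ≤-trans (s≤s (2≤∣p∣ (x∈p∧x≢y⇒x∈p-y y∈p (x≢y ∘ ≡.sym)) (x∈p∧x≢y⇒x∈p-y z∈p (x≢z ∘ ≡.sym)) y≢z))
          (x∈p⇒∣p-x∣<∣p∣ x∈p)

∣p∣≡1⇒≡ : ∀ {n} {x y : Fin n} {p} → ∣ p ∣ ≡ 1 → x ∈ p → y ∈ p → x ≡ y
∣p∣≡1⇒≡ {x = x} {y} ∣p∣≡1 x∈p y∈p with x ≟ᶠ y
... | yes x≡y = x≡y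
... | no x≢y with subst (2 ≤_) ∣p∣≡1 (2≤∣p∣ x∈p y∈p x≢y)
...   | s≤s ()

⊆⁅x⁆⇒∣p∣≡1 : ∀ {n} {x : Fin n} {p} → x ∈ p → (∀ {y} → y ∈ p → y ≡ x) → ∣ p ∣ ≡ 1
⊆⁅x⁆⇒∣p∣≡1 {x = x} x∈p ⊆⁅x⁆ = ≤-antisym
  (≤-trans (p⊆q⇒∣p∣≤∣q∣ (λ y∈p → from x∈⁅y⁆⇔x≡y (⊆⁅x⁆ y∈p))) (≤-reflexive (∣⁅x⁆∣≡1 x)))
  (1≤∣p∣ x∈p)

∣p∪q∣≤∣p∣+∣q∣ : ∀ {n} (p q : Subset n) → ∣ p ∪ q ∣ ≤ ∣ p ∣ + ∣ q ∣
∣p∪q∣≤∣p∣+∣q∣ []            []            = z≤n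
∣p∪q∣≤∣p∣+∣q∣ (inside ∷ p)  (inside ∷ q)  =
  s≤s (≤-trans (∣p∪q∣≤∣p∣+∣q∣ p q) (+-monoʳ-≤ ∣ p ∣ (n≤1+n ∣ q ∣)))
∣p∪q∣≤∣p∣+∣q∣ (inside ∷ p)  (outside ∷ q) = s≤s (∣p∪q∣≤∣p∣+∣q∣ p q)
∣p∪q∣≤∣p∣+∣q∣ (outside ∷ p) (inside ∷ q)  =
  ≤-trans (s≤s (∣p∪q∣≤∣p∣+∣q∣ p q)) (≤-reflexive (≡.sym (+-suc ∣ p ∣ ∣ q ∣)))
∣p∪q∣≤∣p∣+∣q∣ (outside ∷ p) (outside ∷ q) = ∣p∪q∣≤∣p∣+∣q∣ p q

image : ∀ {n m} → (Fin n → Fin m) → Subset n → Subset m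
image φ []            = ∅
image φ (outside ∷ S) = image (φ ∘ suc) S
image φ (inside ∷ S)  = ⁅ φ zero ⁆ ∪ image (φ ∘ suc) S

∣image∣≤∣S∣ : ∀ {n m} (φ : Fin n → Fin m) (S : Subset n) → ∣ image φ S ∣ ≤ ∣ S ∣
∣image∣≤∣S∣ {m = m} φ [] = ≤-reflexive (∣⊥∣≡0 m)
∣image∣≤∣S∣ φ (outside ∷ S) = ∣image∣≤∣S∣ (φ ∘ suc) S
∣image∣≤∣S∣ φ (inside ∷ S)  = begin
  ∣ ⁅ φ zero ⁆ ∪ image (φ ∘ suc) S ∣        ≤⟨ ∣p∪q∣≤∣p∣+∣q∣ ⁅ φ zero ⁆ (image (φ ∘ suc) S) ⟩
  ∣ ⁅ φ zero ⁆ ∣ + ∣ image (φ ∘ suc) S ∣    ≡⟨ ≡.cong (_+ ∣ image (φ ∘ suc) S ∣) (∣⁅x⁆∣≡1 (φ zero)) ⟩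
  suc ∣ image (φ ∘ suc) S ∣                 ≤⟨ s≤s (∣image∣≤∣S∣ (φ ∘ suc) S) ⟩
  suc ∣ S ∣                                 ∎
  where open Data.Nat.Properties.≤-Reasoning

∈image : ∀ {n m} (φ : Fin n → Fin m) {S : Subset n} {s} → s ∈ S → φ s ∈ image φ S
∈image φ {inside ∷ S}  here         = x∈p∪q⁺ (inj₁ (x∈⁅x⁆ (φ zero)))
∈image φ {inside ∷ S}  (there s∈S) = x∈p∪q⁺ {p = ⁅ φ zero ⁆} (inj₂ (∈image (φ ∘ suc) s∈S))
∈image φ {outside ∷ S} (there s∈S) = ∈image (φ ∘ suc) s∈S

iterate-inflationary : ∀ {n} (f : Subset n → Subset n) → (∀ {P} → P ⊆ f P) →
                       ∀ i {P} → P ⊆ iterate f i P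
iterate-inflationary f inflationary zero    = λ x∈P → x∈P
iterate-inflationary f inflationary (suc i) = inflationary ∘ iterate-inflationary f inflationary i

inflationary⇒fixed⊎grows : ∀ {n} (f : Subset n → Subset n) → (∀ {P} → P ⊆ f P) →
                           ∀ Q → f Q ≡ Q ⊎ ∣ Q ∣ < ∣ f Q ∣
inflationary⇒fixed⊎grows f inflationary Q with any? (λ x → x ∈? f Q ×-dec ¬? (x ∈? Q))
... | yes (x , x∈fQ , x∉Q) = inj₂ (p⊂q⇒∣p∣<∣q∣ (inflationary , x , x∈fQ , x∉Q))
... | no none = inj₁ (⊆-antisym fQ⊆Q inflationary)
  where
  fQ⊆Q : f Q ⊆ Q
  fQ⊆Q {x} x∈fQ = decidable-stable (x ∈? Q) (λ x∉Q → none (x , x∈fQ , x∉Q))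

iterate-fixed⊎large : ∀ {n} (f : Subset n → Subset n) → (∀ {P} → P ⊆ f P) → ∀ P k →
                      ∃[ i ] (f (iterate f i P) ≡ iterate f i P) ⊎ k ≤ ∣ iterate f k P ∣
iterate-fixed⊎large f inflationary P zero = inj₂ z≤n
iterate-fixed⊎large f inflationary P (suc k) with iterate-fixed⊎large f inflationary P k
... | inj₁ fixpoint = inj₁ fixpoint
... | inj₂ k≤ with inflationary⇒fixed⊎grows f inflationary (iterate f k P)
...   | inj₁ fixed  = inj₁ (k , fixed)
...   | inj₂ larger = inj₂ (≤-trans (s≤s k≤) larger)

iterate-fixpoint : ∀ {n} (f : Subset n → Subset n) → (∀ {P} → P ⊆ f P) →
                   ∀ P → ∃[ i ] (f (iterate f i P) ≡ iterate f i P)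
iterate-fixpoint {n} f inflationary P with iterate-fixed⊎large f inflationary P (suc n)
... | inj₁ fixpoint = fixpoint
... | inj₂ n<size   = ⊥-elim (<-irrefl refl (≤-trans n<size (∣p∣≤n (iterate f (suc n) P))))

module _ {n} (G : Graph n) where

  adjSym : ∀ {u v} → Adj G u v → Adj G v u
  adjSym {u} {v} = subst T (sym G u v)

  ∈N⁺ : ∀ {v u} → Adj G v u → u ∈ N G v
  ∈N⁺ {v} = ∈-tabulate⁺ (adj G v)

  ∈N⁻ : ∀ {v u} → u ∈ N G v → Adj G v u
  ∈N⁻ {v} = ∈-tabulate⁻ (adj G v)

  AtMostTwoNeighbours : Fin n → Set
  AtMostTwoNeighbours v =
    ∀ {a b d} → Adj G v a → Adj G v b → Adj G v d → a ≢ b → a ≢ d → b ≢ d → ⊥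

  deg≤2⇒atMostTwoNeighbours : ∀ {v} → deg G v ≤ 2 → AtMostTwoNeighbours v
  deg≤2⇒atMostTwoNeighbours deg≤2 va vb vd a≢b a≢d b≢d
    with ≤-trans (3≤∣p∣ (∈N⁺ va) (∈N⁺ vb) (∈N⁺ vd) a≢b a≢d b≢d) deg≤2
  ... | s≤s (s≤s ())

  module _ (b : Fin n → Bool) where

    ∈⋃N⁻ : ∀ {x} → x ∈ ⋃ (map (N G) (filter (T? ∘ b) (allFin n))) → ∃[ v ] (T (b v) × Adj G v x)
    ∈⋃N⁻ x∈ with ∈⋃⁻ _ x∈
    ... | p , p∈ , x∈p with ∈-map⁻ (N G) p∈
    ...   | v , v∈ , refl = v , proj₂ (∈-filter⁻ (T? ∘ b) {xs = allFin n} v∈) , ∈N⁻ x∈p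

    ∈⋃N⁺ : ∀ {v x} → T (b v) → Adj G v x → x ∈ ⋃ (map (N G) (filter (T? ∘ b) (allFin n)))
    ∈⋃N⁺ {v} bv vx = ∈⋃⁺ _ (∈-map⁺ (N G) (∈-filter⁺ (T? ∘ b) (∈-allFin v) bv)) (∈N⁺ vx)

  ∈closedNbhd⁻ : ∀ {S x} → x ∈ closedNbhd G S → x ∈ S ⊎ ∃[ v ] (v ∈ S × Adj G v x)
  ∈closedNbhd⁻ {S} x∈ with x∈p∪q⁻ S _ x∈
  ... | inj₁ x∈S  = inj₁ x∈S
  ... | inj₂ x∈NS with ∈⋃N⁻ (lookup S) x∈NS
  ...   | v , v∈S , vx = inj₂ (v , T-lookup⇒∈ v∈S , vx)

  S⊆closedNbhd : ∀ {S} → S ⊆ closedNbhd G S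
  S⊆closedNbhd x∈S = x∈p∪q⁺ (inj₁ x∈S)

  N⊆closedNbhd : ∀ {S v x} → v ∈ S → Adj G v x → x ∈ closedNbhd G S
  N⊆closedNbhd {S} v∈S vx = x∈p∪q⁺ {p = S} (inj₂ (∈⋃N⁺ (lookup S) (∈⇒T-lookup v∈S) vx))

  forces⁻ : ∀ {P v} → T (forces G P v) → v ∈ P × ∣ N G v ─ P ∣ ≡ 1
  forces⁻ {P} {v} t with to (T-∧ {lookup P v}) t
  ... | v∈P , one = T-lookup⇒∈ v∈P , ≡ᵇ⇒≡ _ 1 one

  forces⁺ : ∀ {P v} → v ∈ P → ∣ N G v ─ P ∣ ≡ 1 → T (forces G P v)
  forces⁺ {P} {v} v∈P one = from (T-∧ {lookup P v}) (∈⇒T-lookup v∈P , ≡⇒≡ᵇ _ 1 one)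

  ∈propStep⁻ : ∀ {P x} → x ∈ propStep G P → x ∈ P ⊎ ∃[ v ] (T (forces G P v) × Adj G v x)
  ∈propStep⁻ {P} x∈ with x∈p∪q⁻ P _ x∈
  ... | inj₁ x∈P      = inj₁ x∈P
  ... | inj₂ x∈forced = inj₂ (∈⋃N⁻ (forces G P) x∈forced)

  P⊆propStep : ∀ {P} → P ⊆ propStep G P
  P⊆propStep x∈P = x∈p∪q⁺ (inj₁ x∈P)

  forced∈propStep : ∀ {P v x} → T (forces G P v) → Adj G v x → x ∈ propStep G P
  forced∈propStep {P} v⇒ vx = x∈p∪q⁺ {p = P} (inj₂ (∈⋃N⁺ (forces G P) v⇒ vx))

  ForcingClosed : (Fin n → Set) → Set
  ForcingClosed Q = ∀ {v w} → Q v → Adj G v w → (∀ {u} → Adj G v u → ¬ Q u → u ≡ w) → Q w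

  𝒫⊆forcingClosed : ∀ {Q S} → ForcingClosed Q → (∀ {x} → x ∈ closedNbhd G S → Q x) →
                    ∀ ℓ {x} → x ∈ 𝒫 G ℓ S → Q x
  𝒫⊆forcingClosed closed N[S]⊆Q zero = N[S]⊆Q
  𝒫⊆forcingClosed {Q} {S} closed N[S]⊆Q (suc ℓ) {x} x∈ = from-step (x ∈? P) (∈propStep⁻ x∈)
    where
    P : Subset n
    P = 𝒫 G ℓ S

    IH : ∀ {y} → y ∈ P → Q y
    IH = 𝒫⊆forcingClosed closed N[S]⊆Q ℓ

    from-step : Dec (x ∈ P) → x ∈ P ⊎ ∃[ v ] (T (forces G P v) × Adj G v x) → Q x
    from-step (yes x∈P) _                    = IH x∈P
    from-step (no x∉P)  (inj₁ x∈P)           = ⊥-elim (x∉P x∈P)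
    from-step (no x∉P)  (inj₂ (v , v⇒ , vx)) = closed (IH (proj₁ (forces⁻ v⇒))) vx only-x
      where
      only-x : ∀ {u} → Adj G v u → ¬ Q u → u ≡ x
      only-x vu ¬Qu = ∣p∣≡1⇒≡ (proj₂ (forces⁻ v⇒))
        (x∈p∧x∉q⇒x∈p─q (∈N⁺ vu) (¬Qu ∘ IH)) (x∈p∧x∉q⇒x∈p─q (∈N⁺ vx) x∉P)

  fixpoint⇒forcingClosed : ∀ {C} → propStep G C ≡ C → ForcingClosed (_∈ C)
  fixpoint⇒forcingClosed {C} fixed {v} {w} v∈C vw only-w with w ∈? C
  ... | yes w∈C = w∈C
  ... | no w∉C  = subst (w ∈_) fixed (forced∈propStep (forces⁺ v∈C one) vw)
    where
    one : ∣ N G v ─ C ∣ ≡ 1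
    one = ⊆⁅x⁆⇒∣p∣≡1 (x∈p∧x∉q⇒x∈p─q (∈N⁺ vw) w∉C)
            (λ u∈ → only-w (∈N⁻ (p─q⊆p _ C u∈)) (x∈p─q⇒x∉q _ C u∈))

  forcingClosed-saturates : ∀ {Q v a} → ForcingClosed Q → AtMostTwoNeighbours v →
                            Q v → Adj G v a → Q a → ∀ {b} → Adj G v b → Q b
  forcingClosed-saturates {Q} {v} {a} closed atMostTwo Qv va Qa {b} vb with a ≟ᶠ b
  ... | yes refl = Qa
  ... | no a≢b   = closed Qv vb only-b
    where
    only-b : ∀ {u} → Adj G v u → ¬ Q u → u ≡ b
    only-b {u} vu ¬Qu with u ≟ᶠ b
    ... | yes u≡b = u≡b
    ... | no u≢b  = ⊥-elim (atMostTwo va vb vu a≢b (λ { refl → ¬Qu Qa }) (u≢b ∘ ≡.sym))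

ExternalNeighbour : ∀ {n} → Graph n → Subset n → Fin n → Set
ExternalNeighbour G X e = e ∉ X × ∃[ x ] (x ∈ X × Adj G x e)

module _ {n} (G : Graph n) (X : Subset n) (connected : InducedConnected G X)
         (deg≤2 : ∀ x → x ∈ X → deg G x ≤ 2) where

  open DecListMembership (_≟ᶠ_ {n}) using () renaming (_∈?_ to _∈ˡ?_)

  atMostTwo : ∀ {x} → x ∈ X → AtMostTwoNeighbours G x
  atMostTwo {x} x∈X = deg≤2⇒atMostTwoNeighbours G (deg≤2 x x∈X)

  next : List (Fin n) → Fin n → Fin n
  next []      b = b
  next (z ∷ _) _ = z

  -- y ∷ l followed by b is a walk whose vertices other than b lie in X and in which no vertex
  -- equals the one two steps later.
  data NBWalk (b : Fin n) : Fin n → List (Fin n) → Set where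
    end  : ∀ {y} → y ∈ X → Adj G y b → NBWalk b y []
    more : ∀ {y z l} → y ∈ X → Adj G y z → y ≢ next l b → NBWalk b z l → NBWalk b y (z ∷ l)

  NBWalk⊆X : ∀ {b y l t} → NBWalk b y l → t ∈ˡ (y ∷ l) → t ∈ X
  NBWalk⊆X (end y∈X _)      (hereˡ refl) = y∈X
  NBWalk⊆X (more y∈X _ _ _) (hereˡ refl) = y∈X
  NBWalk⊆X (more _ _ _ w)   (thereˡ t∈)  = NBWalk⊆X w t∈

  NBWalk-adj-next : ∀ {b y l} → NBWalk b y l → Adj G y (next l b)
  NBWalk-adj-next (end _ yb)      = yb
  NBWalk-adj-next (more _ yz _ _) = yz

  next≡b⊎∈X : ∀ {b y l} → NBWalk b y l → next l b ≡ b ⊎ next l b ∈ X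
  next≡b⊎∈X (end _ _)      = inj₁ refl
  next≡b⊎∈X (more _ _ _ w) = inj₂ (NBWalk⊆X w (hereˡ refl))

  -- A step y → w that would immediately return to y is cancelled.
  prepend : ∀ {b y w l} → b ∉ X → y ∈ X → Adj G y w → NBWalk b w l → ∃[ l' ] NBWalk b y l'
  prepend b∉X y∈X yw w@(end _ _) = _ , more y∈X yw (λ { refl → b∉X y∈X }) w
  prepend {y = y} b∉X y∈X yw w@(more {z = z} _ _ _ w') with y ≟ᶠ z
  ... | yes refl = _ , w'
  ... | no y≢z   = _ , more y∈X yw y≢z w

  walk⇒NBWalk : ∀ {b u v} → b ∉ X → ReachIn G X u v → Adj G v b → ∃[ l ] NBWalk b u l
  walk⇒NBWalk b∉X (here u∈X)        vb = [] , end u∈X vb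
  walk⇒NBWalk b∉X (step u∈X uw walk) vb = prepend b∉X u∈X uw (proj₂ (walk⇒NBWalk b∉X walk vb))

  -- Extended by a at the front, every vertex of the walk has both its walk-neighbours, and these
  -- are distinct; degree at most 2 leaves no room for another neighbour.
  NBWalk-neighbours : ∀ {a b y l t z} → NBWalk b y l → Adj G y a → a ≢ next l b →
                      t ∈ˡ (y ∷ l) → Adj G t z → z ∈ˡ (a ∷ b ∷ y ∷ l)
  NBWalk-neighbours {a} {b} {y} {l} {z = z} w ya a≢next (hereˡ refl) yz with z ≟ᶠ a | z ≟ᶠ next l b
  ... | yes refl | _        = hereˡ refl
  ... | no _     | yes refl = next∈ w
    where
    next∈ : ∀ {y l} → NBWalk b y l → next l b ∈ˡ (a ∷ b ∷ y ∷ l)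
    next∈ (end _ _)      = thereˡ (hereˡ refl)
    next∈ (more _ _ _ _) = thereˡ (thereˡ (thereˡ (hereˡ refl)))
  ... | no z≢a   | no z≢next = ⊥-elim (atMostTwo (NBWalk⊆X w (hereˡ refl))
                                  ya (NBWalk-adj-next w) yz a≢next (z≢a ∘ ≡.sym) (z≢next ∘ ≡.sym))
  NBWalk-neighbours (more _ yz y≢next w) _ _ (thereˡ t∈) tz
    with NBWalk-neighbours w (adjSym G yz) y≢next t∈ tz
  ... | hereˡ e            = thereˡ (thereˡ (hereˡ e))
  ... | thereˡ (hereˡ e)   = thereˡ (hereˡ e)
  ... | thereˡ (thereˡ z∈) = thereˡ (thereˡ (thereˡ z∈))

  crossing-edge : ∀ {u v} (L : List (Fin n)) → ReachIn G X u v → u ∉ˡ L → v ∈ˡ L →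
                  ∃[ q ] ∃[ t ] (q ∈ X × q ∉ˡ L × t ∈ˡ L × Adj G q t)
  crossing-edge L (here _) u∉L u∈L = ⊥-elim (u∉L u∈L)
  crossing-edge L (step {u} {w} u∈X uw walk) u∉L v∈L with w ∈ˡ? L
  ... | yes w∈L = u , w , u∈X , u∉L , w∈L , uw
  ... | no w∉L  = crossing-edge L walk w∉L v∈L

  -- The walk from x₁ through X to e₂, extended by e₁, is saturated: no vertex on it has another
  -- neighbour, so neither x₃ nor the entry point of a path from x₃ can exist.
  noThreeExternalNeighbours : ∀ {e₁ e₂ e₃} →
    ExternalNeighbour G X e₁ → ExternalNeighbour G X e₂ → ExternalNeighbour G X e₃ →
    e₁ ≢ e₂ → e₁ ≢ e₃ → e₂ ≢ e₃ → ⊥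
  noThreeExternalNeighbours {e₁} {e₂} {e₃} (e₁∉X , x₁ , x₁∈X , x₁e₁) (e₂∉X , x₂ , x₂∈X , x₂e₂)
                            (e₃∉X , x₃ , x₃∈X , x₃e₃) e₁≢e₂ e₁≢e₃ e₂≢e₃ =
    let l , w = walk⇒NBWalk e₂∉X (connected x₁ x₂ x₁∈X x₂∈X) x₂e₂ in saturated l w
    where
    saturated : ∀ l → NBWalk e₂ x₁ l → ⊥
    saturated l w = x₃-on-walk? (x₃ ∈ˡ? (x₁ ∷ l))
      where
      e₁≢next : e₁ ≢ next l e₂
      e₁≢next e₁≡next with next≡b⊎∈X w
      ... | inj₁ next≡e₂ = e₁≢e₂ (trans e₁≡next next≡e₂)
      ... | inj₂ next∈X  = e₁∉X (subst (_∈ X) (≡.sym e₁≡next) next∈X)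

      neighbours : ∀ {t z} → t ∈ˡ (x₁ ∷ l) → Adj G t z → z ∈ˡ (e₁ ∷ e₂ ∷ x₁ ∷ l)
      neighbours = NBWalk-neighbours w x₁e₁ e₁≢next

      e₃∉ : e₃ ∉ˡ (e₁ ∷ e₂ ∷ x₁ ∷ l)
      e₃∉ (hereˡ e₃≡e₁)          = e₁≢e₃ (≡.sym e₃≡e₁)
      e₃∉ (thereˡ (hereˡ e₃≡e₂)) = e₂≢e₃ (≡.sym e₃≡e₂)
      e₃∉ (thereˡ (thereˡ e₃∈))  = e₃∉X (NBWalk⊆X w e₃∈)

      X-outside-walk : ∀ {q} → q ∈ X → q ∉ˡ (x₁ ∷ l) → q ∉ˡ (e₁ ∷ e₂ ∷ x₁ ∷ l)
      X-outside-walk q∈X _  (hereˡ refl)          = e₁∉X q∈X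
      X-outside-walk q∈X _  (thereˡ (hereˡ refl)) = e₂∉X q∈X
      X-outside-walk _   q∉ (thereˡ (thereˡ q∈))  = q∉ q∈

      x₃-on-walk? : Dec (x₃ ∈ˡ (x₁ ∷ l)) → ⊥
      x₃-on-walk? (yes x₃∈) = e₃∉ (neighbours x₃∈ x₃e₃)
      x₃-on-walk? (no x₃∉) with crossing-edge (x₁ ∷ l) (connected x₃ x₁ x₃∈X x₁∈X) x₃∉ (hereˡ refl)
      ... | q , t , q∈X , q∉ , t∈ , qt = X-outside-walk q∈X q∉ (neighbours t∈ (adjSym G qt))

module _ {n m} {G : Graph n} {X : Subset n} {H : Graph m} {φ : Fin n → Fin m} {c : Fin m}
         (contraction : IsContraction G X H φ c) where

  open IsContraction contraction

  φ-adj-outside : ∀ {u w} → u ∉ X → w ∉ X → Adj G u w → Adj H (φ u) (φ w)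
  φ-adj-outside {u} {w} u∉X w∉X = subst T (≡.sym (adjOut u w u∉X w∉X))

  c-adj : ∀ {x u} → x ∈ X → u ∉ X → Adj G x u → Adj H c (φ u)
  c-adj {x} {u} x∈X u∉X = proj₂ (adjC u u∉X) x x∈X

  φ-adj⁻ : ∀ {u w} → u ∉ X → Adj H (φ u) w → ∃[ v ] (Adj G u v × φ v ≡ w)
  φ-adj⁻ {u} {w} u∉X φu-w with w ≟ᶠ c
  ... | yes refl = let x , x∈X , xu = proj₁ (adjC u u∉X) (adjSym H φu-w) in
                   x , adjSym G xu , onX x x∈X
  ... | no w≢c with surj w w≢c
  ...   | v , v∉X , refl = v , subst T (adjOut u v u∉X v∉X) φu-w , refl

  c-adj⁻ : ∀ {w} → Adj H c w → ∃[ e ] (ExternalNeighbour G X e × φ e ≡ w)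
  c-adj⁻ {w} cw with w ≟ᶠ c
  ... | yes refl = ⊥-elim (subst T (irrefl H c) cw)
  ... | no w≢c with surj w w≢c
  ...   | e , e∉X , refl = e , (e∉X , proj₁ (adjC e e∉X) cw) , refl

  φ-surjective : Nonempty X → ∀ w → ∃[ u ] (φ u ≡ w)
  φ-surjective (x , x∈X) w with w ≟ᶠ c
  ... | yes refl = x , onX x x∈X
  ... | no w≢c   = let u , _ , φu≡w = surj w w≢c in u , φu≡w

  c-atMostTwoNeighbours : InducedConnected G X → (∀ x → x ∈ X → deg G x ≤ 2) →
                          AtMostTwoNeighbours H c
  c-atMostTwoNeighbours connected deg≤2 ca cb cd a≢b a≢d b≢d
    with c-adj⁻ ca | c-adj⁻ cb | c-adj⁻ cd
  ... | _ , ext₁ , refl | _ , ext₂ , refl | _ , ext₃ , refl =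
    noThreeExternalNeighbours G X connected deg≤2 ext₁ ext₂ ext₃
      (a≢b ∘ ≡.cong φ) (a≢d ∘ ≡.cong φ) (b≢d ∘ ≡.cong φ)

  module Pullback (C : Subset m) (closed : ForcingClosed H (_∈ C))
                  (c-atMostTwo : AtMostTwoNeighbours H c) where

    Covered : Fin n → Set
    Covered u = φ u ∈ C × (u ∈ X → ∀ {w} → Adj H c w → w ∈ C)

    covered-outside : ∀ {u} → u ∉ X → φ u ∈ C → Covered u
    covered-outside u∉X φu∈C = φu∈C , λ u∈X → ⊥-elim (u∉X u∈X)

    covered-inside : ∀ {x} → x ∈ X → c ∈ C → (∀ {w} → Adj H c w → w ∈ C) → Covered x
    covered-inside {x} x∈X c∈C N[c]⊆C = subst (_∈ C) (≡.sym (onX x x∈X)) c∈C , λ _ → N[c]⊆C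

    covered-by-neighbour : ∀ {x a} → x ∈ X → c ∈ C → Adj H c a → a ∈ C → Covered x
    covered-by-neighbour x∈X c∈C ca a∈C =
      covered-inside x∈X c∈C (forcingClosed-saturates H closed c-atMostTwo c∈C ca a∈C)

    forced-image : ∀ {v w} → v ∉ X → (∀ {u} → Adj G v u → ¬ Covered u → u ≡ w) →
                   ∀ {u} → Adj H (φ v) u → u ∉ C → u ≡ φ w
    forced-image v∉X only-w φv-u u∉C with φ-adj⁻ v∉X φv-u
    ... | _ , vu , refl = ≡.cong φ (only-w vu (u∉C ∘ proj₁))

    covered-forcingClosed : ForcingClosed G Covered
    covered-forcingClosed {v} {w} (φv∈C , N[c]⊆C) vw only-w with v ∈? X | w ∈? X
    ... | yes v∈X | yes w∈X = covered-inside w∈X (subst (_∈ C) (onX v v∈X) φv∈C) (N[c]⊆C v∈X)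
    ... | yes v∈X | no w∉X  = covered-outside w∉X (N[c]⊆C v∈X (c-adj v∈X w∉X vw))
    ... | no v∉X  | yes w∈X = covered-by-neighbour w∈X c∈C cφv φv∈C
      where
      cφv : Adj H c (φ v)
      cφv = c-adj w∈X v∉X (adjSym G vw)
      c∈C : c ∈ C
      c∈C = closed φv∈C (adjSym H cφv)
              (λ φv-u u∉C → trans (forced-image v∉X only-w φv-u u∉C) (onX w w∈X))
    ... | no v∉X  | no w∉X  =
      covered-outside w∉X (closed φv∈C (φ-adj-outside v∉X w∉X vw) (forced-image v∉X only-w))

    module _ {S : Subset n} {S' : Subset m} (φS⊆S' : ∀ {s} → s ∈ S → φ s ∈ S')
             (N[S']⊆C : closedNbhd H S' ⊆ C) where

      c∈S' : ∀ {s} → s ∈ S → s ∈ X → c ∈ S'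
      c∈S' {s} s∈S s∈X = subst (_∈ S') (onX s s∈X) (φS⊆S' s∈S)

      covered-via-c : ∀ {x} → c ∈ S' → x ∈ X → Covered x
      covered-via-c c∈S' x∈X =
        covered-inside x∈X (N[S']⊆C (S⊆closedNbhd H c∈S')) (N[S']⊆C ∘ N⊆closedNbhd H c∈S')

      N[S]⊆Covered : ∀ {u} → u ∈ closedNbhd G S → Covered u
      N[S]⊆Covered {u} u∈ with ∈closedNbhd⁻ G u∈
      ... | inj₁ u∈S with u ∈? X
      ...   | yes u∈X = covered-via-c (c∈S' u∈S u∈X) u∈X
      ...   | no u∉X  = covered-outside u∉X (N[S']⊆C (S⊆closedNbhd H (φS⊆S' u∈S)))
      N[S]⊆Covered {u} u∈ | inj₂ (s , s∈S , su) with s ∈? X | u ∈? X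
      ... | yes s∈X | yes u∈X = covered-via-c (c∈S' s∈S s∈X) u∈X
      ... | yes s∈X | no u∉X  =
        covered-outside u∉X (N[S']⊆C (N⊆closedNbhd H (c∈S' s∈S s∈X) (c-adj s∈X u∉X su)))
      ... | no s∉X  | yes u∈X =
        covered-by-neighbour u∈X (N[S']⊆C (N⊆closedNbhd H φs∈S' (adjSym H cφs))) cφs
          (N[S']⊆C (S⊆closedNbhd H φs∈S'))
        where
        φs∈S' : φ s ∈ S'
        φs∈S' = φS⊆S' s∈S
        cφs : Adj H c (φ s)
        cφs = c-adj u∈X s∉X (adjSym G su)
      ... | no s∉X  | no u∉X  =
        covered-outside u∉X (N[S']⊆C (N⊆closedNbhd H (φS⊆S' s∈S) (φ-adj-outside s∉X u∉X su)))

  contraction-preserves-PDS : InducedConnected G X → (∀ x → x ∈ X → deg G x ≤ 2) → Nonempty X →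
                              ∀ {S S'} → IsPDS G S → (∀ {s} → s ∈ S → φ s ∈ S') → IsPDS H S'
  contraction-preserves-PDS connected deg≤2 X≢∅ {S} {S'} (ℓ , 𝒫≡⊤) φS⊆S'
    with iterate-fixpoint (propStep H) (P⊆propStep H) (closedNbhd H S')
  ... | i , fixed = i , ⊆-antisym ⊆⊤ (λ {w} _ → in-closure w)
    where
    C : Subset m
    C = 𝒫 H i S'
    open Pullback C (fixpoint⇒forcingClosed H fixed) (c-atMostTwoNeighbours connected deg≤2)

    everyone-covered : ∀ u → Covered u
    everyone-covered u =
      𝒫⊆forcingClosed G covered-forcingClosed
        (N[S]⊆Covered φS⊆S' (iterate-inflationary (propStep H) (P⊆propStep H) i)) ℓ
        (subst (u ∈_) (≡.sym 𝒫≡⊤) ∈⊤)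

    in-closure : ∀ w → w ∈ C
    in-closure w = let u , φu≡w = φ-surjective X≢∅ w in subst (_∈ C) φu≡w (proj₁ (everyone-covered u))

K₁ : Graph 1
K₁ = record { adj = λ _ _ → false ; sym = λ _ _ → refl ; irrefl = λ _ → refl }

𝒫-K₁-∅ : ∀ ℓ → 𝒫 K₁ ℓ ∅ ≡ ∅
𝒫-K₁-∅ zero = refl
𝒫-K₁-∅ (suc ℓ) rewrite 𝒫-K₁-∅ ℓ = refl

γP-K₁ : IsPowerDomNumber K₁ 1
γP-K₁ = (⊤ , (0 , refl) , refl) , minimal
  where
  minimal : ∀ S → IsPDS K₁ S → 1 ≤ ∣ S ∣
  minimal (inside ∷ [])  _         = s≤s z≤n
  minimal (outside ∷ []) (ℓ , 𝒫≡⊤) with trans (≡.sym (𝒫-K₁-∅ ℓ)) 𝒫≡⊤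
  ... | ()

K₁/K₁ : IsContraction K₁ ⊤ K₁ (λ x → x) zero
K₁/K₁ = record
  { onX    = λ { zero _ → refl }
  ; offX   = λ { zero 0∉⊤ → ⊥-elim (0∉⊤ here) }
  ; inj    = λ { zero zero _ _ _ → refl }
  ; surj   = λ { zero 0≢0 → ⊥-elim (0≢0 refl) }
  ; adjOut = λ { zero zero 0∉⊤ _ → ⊥-elim (0∉⊤ here) }
  ; adjC   = λ { zero 0∉⊤ → ⊥-elim (0∉⊤ here) }
  }

γP-contraction≤ : ∀ {n m} {G : Graph n} {X : Subset n} {H : Graph m} {φ : Fin n → Fin m} {c : Fin m} →
                  Nonempty X → InducedConnected G X → (∀ x → x ∈ X → deg G x ≤ 2) →
                  IsContraction G X H φ c →
                  ∀ {k k'} → IsPowerDomNumber G k → IsPowerDomNumber H k' → k' ≤ k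
γP-contraction≤ {φ = φ} X≢∅ connected deg≤2 contraction ((S , S-pds , refl) , _) (_ , H-minimal) =
  ≤-trans (H-minimal (image φ S)
                     (contraction-preserves-PDS contraction connected deg≤2 X≢∅ S-pds (∈image φ)))
          (∣image∣≤∣S∣ φ S)

proposition4p8 :
    (∀ {n m} (G : Graph n) (X : Subset n) (H : Graph m) (φ : Fin n → Fin m) (c : Fin m)
       → Connected G → Nonempty X → InducedConnected G X
       → (∀ x → x ∈ X → deg G x ≤ 2)
       → IsContraction G X H φ c
       → ∀ k k' → IsPowerDomNumber G k → IsPowerDomNumber H k' → k' ≤ k)
    × (∃[ n ] ∃[ m ] Σ (Graph n) λ G → Σ (Subset n) λ X → Σ (Graph m) λ H →
         Σ (Fin n → Fin m) λ φ → Σ (Fin m) λ c →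
         Connected G × Nonempty X × InducedConnected G X
         × (∀ x → x ∈ X → deg G x ≤ 2) × IsContraction G X H φ c
         × ∃[ k ] (IsPowerDomNumber G k × IsPowerDomNumber H k))
proposition4p8 =
    (λ G X H φ c _ X≢∅ connected deg≤2 contraction _ _ → γP-contraction≤ X≢∅ connected deg≤2 contraction)
  , ( 1 , 1 , K₁ , ⊤ , K₁ , (λ x → x) , zero
    , (λ { zero zero → here ∈⊤ }) , (zero , ∈⊤) , (λ { zero zero _ _ → here ∈⊤ })
    , (λ { zero _ → z≤n }) , K₁/K₁ , 1 , γP-K₁ , γP-K₁)
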